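{- Let $k$ be a positive integer and let $\mathcal F$ be a non-trivial increasing family of subsets of a finite set $X$. Let $\pi\colon X\times[k]\to X$ be the projection onto the first coordinate and define the $k$-cloned family $\mathcal F_k=\{S\subset X\times[k] : \pi(S)\in\mathcal F\}$. Then \[ q_\mathrm{c}(\mathcal F_k)=\frac1k\, q_\mathrm{c}(\mathcal F). \]
   Context: Here $[k]=\{1,\dots,k\}$ and $\pi(S)$ is the image of $S$ under $\pi$. A family $\mathcal F\subset\mathcal P(X)$ is increasing if $A\in\mathcal F$ and $A\subset B\subset X$ imply $B\in\mathcal F$; it is non-trivial if $\mathcal F\neq\emptyset$ and $\mathcal F\neq \mathcal P(X)$. For a finite set $Y$, $\mathcal G\subset\mathcal P(Y)$ and $q\in[0,1]$, $\mathrm{cost}_q(\mathcal G)=\sum_{S\in\mathcal G} q^{|S|}$; $\mathcal G$ is $q$-cheap if $\mathrm{cost}_q(\mathcal G)\le 1/2$; $\mathcal G$ covers a family $\mathcal F\subset \mathcal P(Y)$ if every $T\in\mathcal F$ contains some $S\in\mathcal G$. The expectation threshold of $\mathcal F\subset\mathcal P(Y)$ is $q_\mathrm{c}(\mathcal F)=\sup\{q\in[0,1]: \text{there exists a } q\text{ -cheap cover } \mathcal G\subset\mathcal P(Y) \text{ of } \mathcal F\}$.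
   Formalization: In the supremum defining the expectation threshold $q_\mathrm{c}$, the parameter q ranges over the rationals in [0,1] rather than over all reals in [0,1]. -}

module Defs where

open import Data.Nat as ℕ using (ℕ; zero; suc)
open import Data.Bool using (Bool; false; _∨_)
open import Data.Fin using (Fin; combine) renaming (zero to fzero; suc to fsuc)
open import Data.Integer using (+_)
open import Relation.Binary.PropositionalEquality using (_≡_)
open import Data.Fin.Subset using (Subset; _⊆_; _∈_; _∉_; ∣_∣)
open import Data.Vec using (tabulate; lookup)
open import Data.List using (List; foldr; map)
open import Data.List.Relation.Unary.Unique.Propositional using (Unique)
open import Data.List.Relation.Unary.Any using (Any)
open import Data.Rational using (ℚ; 0ℚ; 1ℚ; ½; _+_; _*_; _≤_; _<_; _/_)
open import Data.Product using (Σ; ∃; _×_)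
open import Relation.Nullary using (¬_)

Family : ℕ → Set₁
Family n = Subset n → Set

Increasing : ∀ {n} → Family n → Set
Increasing {n} F = ∀ (A B : Subset n) → F A → A ⊆ B → F B

NonTrivial : ∀ {n} → Family n → Set
NonTrivial {n} F = (∃ λ (A : Subset n) → F A) × (∃ λ (A : Subset n) → ¬ F A)

_^ℚ_ : ℚ → ℕ → ℚ
q ^ℚ zero  = 1ℚ
q ^ℚ suc m = q * (q ^ℚ m)

cost : ∀ {m} → ℚ → List (Subset m) → ℚ
cost q G = foldr _+_ 0ℚ (map (λ S → q ^ℚ ∣ S ∣) G)

-- G ⊂ P(Y) is represented by a list without duplicates
Cheap : ∀ {m} → ℚ → List (Subset m) → Set
Cheap q G = cost q G ≤ ½

Covers : ∀ {m} → List (Subset m) → Family m → Set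
Covers {m} G F = ∀ (T : Subset m) → F T → Any (λ S → S ⊆ T) G

CheapCoverable : ∀ {m} → Family m → ℚ → Set
CheapCoverable {m} F q =
  (0ℚ ≤ q) × (q ≤ 1ℚ) ×
  (∃ λ (G : List (Subset m)) → Unique G × Cheap q G × Covers G F)

-- A real number x is represented by its strict lower Dedekind cut
-- {r ∈ ℚ : r < x}.  The cut of sup A for A ⊆ ℚ is {r : ∃ q ∈ A, r < q}.
-- So  r <qc F  means  r < q_c(F).
_<qc_ : ∀ {m} → ℚ → Family m → Set
r <qc F = ∃ λ q → CheapCoverable F q × r < q

-- k⁻¹ · x for the real x = sup A is sup {p/k : p ∈ A}; its cut at r:
-- ∃ p ∈ A, ∃ q with k·q = p and r < q.
_<[_⁻¹·qc_] : ∀ {m} → ℚ → ℕ → Family m → Set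
r <[ k ⁻¹·qc F ] = ∃ λ p → CheapCoverable F p ×
                   ∃ λ q → (q * ((+ k) / 1)) ≡ p × r < q

-- X × [k] is encoded as Fin (n * k) via the bijection combine : Fin n → Fin k → Fin (n * k).
anyᵇ : ∀ k → (Fin k → Bool) → Bool
anyᵇ zero    f = false
anyᵇ (suc k) f = f fzero ∨ anyᵇ k (λ j → f (fsuc j))

image : ∀ {n} k → Subset (n ℕ.* k) → Subset n
image k S = tabulate (λ x → anyᵇ k (λ j → lookup S (combine x j)))

clone : ∀ {n} k → Family n → Family (n ℕ.* k)
clone k F S = F (image k S)

-- A p-cheap cover 𝒢 of F with p = k · q yields a q-cheap cover of F_k: replace every S ∈ 𝒢
-- by its k ^ ∣S∣ lifts, the sets consisting of exactly one clone of each point of S; together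
-- they cost k ^ ∣S∣ · q ^ ∣S∣ = p ^ ∣S∣.
-- Conversely, let 𝒢 be a q-cheap cover of F_k. Every map σ : X → [k] gives the cover
-- 𝒢_σ = {π S : S ∈ 𝒢, S ⊆ graph σ} of F, since each T ∈ F is the image of the part of graph σ
-- over T. A set S lies in graph σ for at most k ^ (n − ∣S∣) of the k ^ n maps σ, and then
-- ∣π S∣ = ∣S∣; so the (k · q)-cost of 𝒢_σ is on average at most cost_q 𝒢 ≤ ½, and some σ
-- gives a (k · q)-cheap cover of F.

module Submission where

open import Defs
open import Data.Nat using (ℕ; _*_; _≥_)
open import Data.Rational using (ℚ)
open import Function.Bundles using (_⇔_)

open import Algebra.Bundles using (CommutativeRing; CommutativeMonoid)
open import Data.Bool using (Bool; true; false; _∨_; if_then_else_)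
import Data.Bool.Properties as Boolₚ
open import Data.Empty using (⊥-elim)
open import Data.Fin using (Fin; combine) renaming (zero to fzero; suc to fsuc)
import Data.Fin as Fin
open import Data.Fin.Properties using (any?)
open import Data.Fin.Subset using (Subset; _⊆_; _∈_; ∣_∣; ⊥; ⊤; ⁅_⁆; Side; inside; outside)
open import Data.Fin.Subset.Properties
  using (_⊆?_; ⊥⊆; ⊆⊤; ⊆-refl; ⊆-trans; ⊆-antisym; drop-∷-⊆; out⊆; in⊆in; ∣⊥∣≡0; ∣⁅x⁆∣≡1;
         x∈⁅x⁆; x∈⁅y⁆⇒x≡y)
import Data.Integer as ℤ
import Data.Integer.Properties as ℤₚ
open import Data.List
  using (List; []; _∷_; foldr; map; filter; concatMap; cartesianProductWith; tabulate; deduplicate)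
  renaming (_++_ to _++ₗ_)
import Data.List.Properties as Listₚ
open import Data.List.Membership.Propositional using (find; lose) renaming (_∈_ to _∈ₗ_)
open import Data.List.Membership.Propositional.Properties
  using (∈-tabulate⁺; ∈-tabulate⁻; ∈-cartesianProductWith⁺; ∈-cartesianProductWith⁻;
         ∈-map⁺; ∈-filter⁺; ∈-concatMap⁺; ∈-deduplicate⁺)
open import Data.List.Relation.Unary.Any using (here; there)
open import Data.List.Relation.Unary.Unique.DecPropositional.Properties using (deduplicate-!)
open import Data.Nat using (zero; suc)
import Data.Nat as ℕ
open import Data.Product using (∃; _×_; _,_)
import Data.Product as Product
import Data.Rational as ℚ
open import Data.Rational using (0ℚ; 1ℚ; ½; _+_; _≤_; _<_; _/_; _≤?_; _<?_; toℚᵘ)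
  renaming (_*_ to _·_)
import Data.Rational.Properties as ℚₚ
import Data.Rational.Unnormalised as ℚᵘ
import Data.Rational.Unnormalised.Properties as ℚᵘₚ
open import Data.Sum using (_⊎_; inj₁; inj₂)
import Data.Sum as Sum
open import Data.Vec using (Vec; []; _∷_; _++_; here; lookup; splitAt)
import Data.Vec.Properties as Vecₚ
open import Function using (_∘_; id)
open import Function.Bundles using (mk⇔; Equivalence)
open import Relation.Binary.Definitions using (DecidableEquality)
open import Relation.Binary.PropositionalEquality
open import Relation.Nullary using (Dec; does; yes; no; ¬_; ¬?)
open import Relation.Nullary.Decidable using (_×-dec_; toWitness; dec-true; dec-false; does-⇔)

open import Algebra.Properties.Semiring.Sum (CommutativeRing.semiring ℚₚ.+-*-commutativeRing)
  using (sum-syntax; sum-cong-≗; ∑-distrib-+; *-distribˡ-sum; *-distribʳ-sum; sum-replicate-zero)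
open import Algebra.Properties.CommutativeSemigroup
  (CommutativeMonoid.commutativeSemigroup ℚₚ.*-1-commutativeMonoid)
  using () renaming (interchange to ·-interchange)

fromℕ : ℕ → ℚ
fromℕ k = ℤ.+ k / 1

fromℕ-suc : ∀ k → fromℕ (suc k) ≡ 1ℚ + fromℕ k
fromℕ-suc k = ℚₚ.toℚᵘ-injective (begin
  toℚᵘ (fromℕ (suc k))             ≈⟨ ℚₚ.toℚᵘ-fromℚᵘ (ℚᵘ.mkℚᵘ (ℤ.+ suc k) 0) ⟩
  ℚᵘ.mkℚᵘ (ℤ.+ suc k) 0            ≈⟨ ℚᵘ.*≡* cross-multiplied ⟩
  toℚᵘ 1ℚ ℚᵘ.+ kᵘ                  ≈⟨ ℚᵘₚ.+-congʳ (toℚᵘ 1ℚ) (ℚₚ.toℚᵘ-fromℚᵘ kᵘ) ⟨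
  toℚᵘ 1ℚ ℚᵘ.+ toℚᵘ (fromℕ k)      ≈⟨ ℚₚ.toℚᵘ-homo-+ 1ℚ (fromℕ k) ⟨
  toℚᵘ (1ℚ + fromℕ k)              ∎)
  where
  open import Relation.Binary.Reasoning.Setoid ℚᵘₚ.≃-setoid
  kᵘ = ℚᵘ.mkℚᵘ (ℤ.+ k) 0
  cross-multiplied : ℤ.+ suc k ℤ.* ℤ.+ 1 ≡ (ℤ.+ 1 ℤ.* ℤ.+ 1 ℤ.+ ℤ.+ k ℤ.* ℤ.+ 1) ℤ.* ℤ.+ 1
  cross-multiplied = trans (ℤₚ.*-identityʳ (ℤ.+ suc k))
    (sym (trans (ℤₚ.*-identityʳ _) (cong (ℤ._+_ (ℤ.+ 1)) (ℤₚ.*-identityʳ (ℤ.+ k)))))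

fromℕ-nonNeg : ∀ k → 0ℚ ≤ fromℕ k
fromℕ-nonNeg zero    = ℚₚ.≤-refl
fromℕ-nonNeg (suc k) = subst (0ℚ ≤_) (sym (fromℕ-suc k))
  (ℚₚ.+-mono-≤ (ℚₚ.nonNegative⁻¹ 1ℚ) (fromℕ-nonNeg k))

1≤fromℕ-suc : ∀ k → 1ℚ ≤ fromℕ (suc k)
1≤fromℕ-suc k = subst₂ _≤_ (ℚₚ.+-identityʳ 1ℚ) (sym (fromℕ-suc k))
  (ℚₚ.+-monoʳ-≤ 1ℚ (fromℕ-nonNeg k))

0≤·fromℕ-suc⇒0≤ : ∀ k {q} → 0ℚ ≤ q · fromℕ (suc k) → 0ℚ ≤ q
0≤·fromℕ-suc⇒0≤ k {q} 0≤qk = ℚₚ.*-cancelʳ-≤-pos (fromℕ (suc k)) {{ℚₚ.normalize-pos (suc k) 1}}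
  (subst (_≤ q · fromℕ (suc k)) (sym (ℚₚ.*-zeroˡ (fromℕ (suc k)))) 0≤qk)

·-monoˡ-≤ : ∀ {r p q} → 0ℚ ≤ r → p ≤ q → r · p ≤ r · q
·-monoˡ-≤ {r} 0≤r = ℚₚ.*-monoˡ-≤-nonNeg r {{ℚ.nonNegative 0≤r}}

·-monoʳ-≤ : ∀ {r p q} → 0ℚ ≤ r → p ≤ q → p · r ≤ q · r
·-monoʳ-≤ {r} 0≤r = ℚₚ.*-monoʳ-≤-nonNeg r {{ℚ.nonNegative 0≤r}}

·-nonNeg : ∀ {p q} → 0ℚ ≤ p → 0ℚ ≤ q → 0ℚ ≤ p · q
·-nonNeg {p} {q} 0≤p 0≤q = subst (_≤ p · q) (ℚₚ.*-zeroʳ p) (·-monoˡ-≤ 0≤p 0≤q)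

≤·fromℕ-suc : ∀ k {q} → 0ℚ ≤ q → q ≤ q · fromℕ (suc k)
≤·fromℕ-suc k {q} 0≤q =
  subst (_≤ q · fromℕ (suc k)) (ℚₚ.*-identityʳ q) (·-monoˡ-≤ 0≤q (1≤fromℕ-suc k))

^-nonNeg : ∀ {q} m → 0ℚ ≤ q → 0ℚ ≤ q ^ℚ m
^-nonNeg zero    0≤q = ℚₚ.nonNegative⁻¹ 1ℚ
^-nonNeg (suc m) 0≤q = ·-nonNeg 0≤q (^-nonNeg m 0≤q)

1≤^ : ∀ {q} m → 1ℚ ≤ q → 1ℚ ≤ q ^ℚ m
1≤^ zero    1≤q = ℚₚ.≤-refl
1≤^ (suc m) 1≤q = ℚₚ.≤-trans (·-monoʳ-≤ (ℚₚ.nonNegative⁻¹ 1ℚ) 1≤q)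
  (·-monoˡ-≤ (ℚₚ.≤-trans (ℚₚ.nonNegative⁻¹ 1ℚ) 1≤q) (1≤^ m 1≤q))

^-+ : ∀ q a b → q ^ℚ (a ℕ.+ b) ≡ q ^ℚ a · q ^ℚ b
^-+ q zero    b = sym (ℚₚ.*-identityˡ _)
^-+ q (suc a) b = trans (cong (q ·_) (^-+ q a b)) (sym (ℚₚ.*-assoc q _ _))

𝟙 : ∀ {p} {P : Set p} → Dec P → ℚ
𝟙 P? = if does P? then 1ℚ else 0ℚ

module _ {p} {P : Set p} where

  𝟙-nonNeg : (P? : Dec P) → 0ℚ ≤ 𝟙 P?
  𝟙-nonNeg (yes _) = ℚₚ.nonNegative⁻¹ 1ℚ
  𝟙-nonNeg (no _)  = ℚₚ.≤-refl

  𝟙-yes : (P? : Dec P) → P → 𝟙 P? ≡ 1ℚ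
  𝟙-yes P? x rewrite dec-true P? x = refl

  𝟙-no : (P? : Dec P) → ¬ P → 𝟙 P? ≡ 0ℚ
  𝟙-no P? ¬x rewrite dec-false P? ¬x = refl

  𝟙·-cong : (P? : Dec P) {a b : ℚ} → (P → a ≡ b) → 𝟙 P? · a ≡ 𝟙 P? · b
  𝟙·-cong (yes x) a≡b = cong (1ℚ ·_) (a≡b x)
  𝟙·-cong (no _)  {a} {b} _ = trans (ℚₚ.*-zeroˡ a) (sym (ℚₚ.*-zeroˡ b))

  𝟙·≤ : (P? : Dec P) {a : ℚ} → 0ℚ ≤ a → 𝟙 P? · a ≤ a
  𝟙·≤ (yes _) {a} _   = ℚₚ.≤-reflexive (ℚₚ.*-identityˡ a)
  𝟙·≤ (no _)  {a} 0≤a = subst (_≤ a) (sym (ℚₚ.*-zeroˡ a)) 0≤a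

  module _ {q} {Q : Set q} where

    𝟙-⇔ : P ⇔ Q → (P? : Dec P) (Q? : Dec Q) → 𝟙 P? ≡ 𝟙 Q?
    𝟙-⇔ P⇔Q P? Q? = cong (if_then 1ℚ else 0ℚ) (does-⇔ P⇔Q P? Q?)

    𝟙-× : (P? : Dec P) (Q? : Dec Q) → 𝟙 (P? ×-dec Q?) ≡ 𝟙 P? · 𝟙 Q?
    𝟙-× (yes _) Q? = sym (ℚₚ.*-identityˡ (𝟙 Q?))
    𝟙-× (no _)  Q? = sym (ℚₚ.*-zeroˡ (𝟙 Q?))

∑-mono-≤ : ∀ {k} {f g : Fin k → ℚ} → (∀ j → f j ≤ g j) → ∑[ j < k ] f j ≤ ∑[ j < k ] g j
∑-mono-≤ {zero}  f≤g = ℚₚ.≤-refl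
∑-mono-≤ {suc k} f≤g = ℚₚ.+-mono-≤ (f≤g fzero) (∑-mono-≤ (f≤g ∘ fsuc))

∑-mono-< : ∀ {k} {f g : Fin (suc k) → ℚ} → (∀ j → f j < g j) →
  ∑[ j < suc k ] f j < ∑[ j < suc k ] g j
∑-mono-< f<g = ℚₚ.+-mono-<-≤ (f<g fzero) (∑-mono-≤ (ℚₚ.<⇒≤ ∘ f<g ∘ fsuc))

∑-≤⇒∃-≤ : ∀ {k} (f g : Fin (suc k) → ℚ) → ∑[ j < suc k ] f j ≤ ∑[ j < suc k ] g j →
  ∃ λ j → f j ≤ g j
∑-≤⇒∃-≤ f g ∑f≤∑g with any? (λ j → f j ≤? g j)
... | yes found = found
... | no  none  = ⊥-elim (ℚₚ.<-irrefl refl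
  (ℚₚ.<-≤-trans (∑-mono-< (λ j → ℚₚ.≰⇒> (λ fj≤gj → none (j , fj≤gj)))) ∑f≤∑g))

∑-const : ∀ k c → ∑[ j < k ] c ≡ fromℕ k · c
∑-const zero    c = sym (ℚₚ.*-zeroˡ c)
∑-const (suc k) c = begin
  c + ∑[ j < k ] c         ≡⟨ cong₂ _+_ (sym (ℚₚ.*-identityˡ c)) (∑-const k c) ⟩
  1ℚ · c + fromℕ k · c     ≡⟨ sym (ℚₚ.*-distribʳ-+ c 1ℚ (fromℕ k)) ⟩
  (1ℚ + fromℕ k) · c       ≡⟨ cong (_· c) (sym (fromℕ-suc k)) ⟩
  fromℕ (suc k) · c        ∎
  where open ≡-Reasoning

∑-𝟙-≟ : ∀ {k} (i : Fin k) → ∑[ j < k ] 𝟙 (i Fin.≟ j) ≡ 1ℚ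
∑-𝟙-≟ {suc k} fzero    = trans (cong (1ℚ +_) (sum-replicate-zero k)) (ℚₚ.+-identityʳ 1ℚ)
∑-𝟙-≟ {suc k} (fsuc i) = trans (ℚₚ.+-identityˡ _) (∑-𝟙-≟ i)

-- ∑ᵛ f sums f over all k ^ n maps σ : Fin n → Fin k, written as vectors.
∑ᵛ : ∀ {k n} → (Vec (Fin k) n → ℚ) → ℚ
∑ᵛ {n = zero}      f = f []
∑ᵛ {k} {n = suc n} f = ∑[ j < k ] ∑ᵛ (λ σ → f (j ∷ σ))

module _ {k : ℕ} where

  ∑ᵛ-cong : ∀ {n} {f g : Vec (Fin k) n → ℚ} → (∀ σ → f σ ≡ g σ) → ∑ᵛ f ≡ ∑ᵛ g
  ∑ᵛ-cong {zero}  f≡g = f≡g []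
  ∑ᵛ-cong {suc n} f≡g = sum-cong-≗ {k} (λ j → ∑ᵛ-cong (λ σ → f≡g (j ∷ σ)))

  ∑ᵛ-mono-≤ : ∀ {n} {f g : Vec (Fin k) n → ℚ} → (∀ σ → f σ ≤ g σ) → ∑ᵛ f ≤ ∑ᵛ g
  ∑ᵛ-mono-≤ {zero}  f≤g = f≤g []
  ∑ᵛ-mono-≤ {suc n} f≤g = ∑-mono-≤ (λ j → ∑ᵛ-mono-≤ (λ σ → f≤g (j ∷ σ)))

  ∑ᵛ-zero : ∀ {n} → ∑ᵛ {k} {n} (λ _ → 0ℚ) ≡ 0ℚ
  ∑ᵛ-zero {zero}  = refl
  ∑ᵛ-zero {suc n} = trans (sum-cong-≗ {k} (λ _ → ∑ᵛ-zero {n})) (sum-replicate-zero k)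

  ∑ᵛ-nonNeg : ∀ {n} {f : Vec (Fin k) n → ℚ} → (∀ σ → 0ℚ ≤ f σ) → 0ℚ ≤ ∑ᵛ f
  ∑ᵛ-nonNeg {n} {f} 0≤f = subst (_≤ ∑ᵛ f) (∑ᵛ-zero {n}) (∑ᵛ-mono-≤ 0≤f)

  ∑ᵛ-distrib-+ : ∀ {n} (f g : Vec (Fin k) n → ℚ) → ∑ᵛ (λ σ → f σ + g σ) ≡ ∑ᵛ f + ∑ᵛ g
  ∑ᵛ-distrib-+ {zero}  f g = refl
  ∑ᵛ-distrib-+ {suc n} f g =
    trans (sum-cong-≗ {k} (λ j → ∑ᵛ-distrib-+ (λ σ → f (j ∷ σ)) (λ σ → g (j ∷ σ))))
          (∑-distrib-+ (λ j → ∑ᵛ (λ σ → f (j ∷ σ))) (λ j → ∑ᵛ (λ σ → g (j ∷ σ))))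

  ·-distribˡ-∑ᵛ : ∀ {n} c (f : Vec (Fin k) n → ℚ) → c · ∑ᵛ f ≡ ∑ᵛ (λ σ → c · f σ)
  ·-distribˡ-∑ᵛ {zero}  c f = refl
  ·-distribˡ-∑ᵛ {suc n} c f =
    trans (*-distribˡ-sum c (λ j → ∑ᵛ (λ σ → f (j ∷ σ))))
          (sum-cong-≗ {k} (λ j → ·-distribˡ-∑ᵛ c (λ σ → f (j ∷ σ))))

∑ᵛ-≤⇒∃-≤ : ∀ {k n} (f g : Vec (Fin (suc k)) n → ℚ) → ∑ᵛ f ≤ ∑ᵛ g →
  ∃ λ σ → f σ ≤ g σ
∑ᵛ-≤⇒∃-≤ {n = zero}  f g f≤g = [] , f≤g
∑ᵛ-≤⇒∃-≤ {n = suc n} f g ∑f≤∑g with ∑-≤⇒∃-≤ _ _ ∑f≤∑g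
... | j , ∑fj≤∑gj with ∑ᵛ-≤⇒∃-≤ _ _ ∑fj≤∑gj
... | σ , fjσ≤gjσ = j ∷ σ , fjσ≤gjσ

-- Defined so that cost q 𝒢 is definitionally ∑ₗ (λ S → q ^ℚ ∣ S ∣) 𝒢.
∑ₗ : ∀ {a} {A : Set a} → (A → ℚ) → List A → ℚ
∑ₗ f xs = foldr _+_ 0ℚ (map f xs)

module _ {a} {A : Set a} where

  ∑ₗ-mono-≤ : ∀ {f g : A → ℚ} (xs : List A) → (∀ x → f x ≤ g x) → ∑ₗ f xs ≤ ∑ₗ g xs
  ∑ₗ-mono-≤ []       f≤g = ℚₚ.≤-refl
  ∑ₗ-mono-≤ (x ∷ xs) f≤g = ℚₚ.+-mono-≤ (f≤g x) (∑ₗ-mono-≤ xs f≤g)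

  ∑ₗ-cong : ∀ {f g : A → ℚ} (xs : List A) → (∀ x → f x ≡ g x) → ∑ₗ f xs ≡ ∑ₗ g xs
  ∑ₗ-cong []       f≡g = refl
  ∑ₗ-cong (x ∷ xs) f≡g = cong₂ _+_ (f≡g x) (∑ₗ-cong xs f≡g)

  ∑ₗ-++ : ∀ (f : A → ℚ) xs ys → ∑ₗ f (xs ++ₗ ys) ≡ ∑ₗ f xs + ∑ₗ f ys
  ∑ₗ-++ f []       ys = sym (ℚₚ.+-identityˡ _)
  ∑ₗ-++ f (x ∷ xs) ys = trans (cong (f x +_) (∑ₗ-++ f xs ys)) (sym (ℚₚ.+-assoc (f x) _ _))

  ·-distribˡ-∑ₗ : ∀ c (f : A → ℚ) xs → c · ∑ₗ f xs ≡ ∑ₗ (λ x → c · f x) xs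
  ·-distribˡ-∑ₗ c f []       = ℚₚ.*-zeroʳ c
  ·-distribˡ-∑ₗ c f (x ∷ xs) =
    trans (ℚₚ.*-distribˡ-+ c (f x) _) (cong (c · f x +_) (·-distribˡ-∑ₗ c f xs))

  ∑ₗ-filter : ∀ {p} {P : A → Set p} (P? : ∀ x → Dec (P x)) (f : A → ℚ) xs →
    ∑ₗ f (filter P? xs) ≡ ∑ₗ (λ x → 𝟙 (P? x) · f x) xs
  ∑ₗ-filter P? f []       = refl
  ∑ₗ-filter P? f (x ∷ xs) with P? x
  ... | yes _ = cong₂ _+_ (sym (ℚₚ.*-identityˡ (f x))) (∑ₗ-filter P? f xs)
  ... | no  _ = trans (∑ₗ-filter P? f xs)
    (sym (trans (cong (_+ _) (ℚₚ.*-zeroˡ (f x))) (ℚₚ.+-identityˡ _)))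

  ∑ₗ-nonNeg : ∀ {f : A → ℚ} xs → (∀ x → 0ℚ ≤ f x) → 0ℚ ≤ ∑ₗ f xs
  ∑ₗ-nonNeg []       0≤f = ℚₚ.≤-refl
  ∑ₗ-nonNeg (x ∷ xs) 0≤f = ℚₚ.+-mono-≤ (0≤f x) (∑ₗ-nonNeg xs 0≤f)

  ∈⇒≤∑ₗ : ∀ {f : A → ℚ} {x} xs → (∀ y → 0ℚ ≤ f y) → x ∈ₗ xs → f x ≤ ∑ₗ f xs
  ∈⇒≤∑ₗ {f} (y ∷ xs) 0≤f (here refl) =
    subst (_≤ f y + ∑ₗ f xs) (ℚₚ.+-identityʳ (f y)) (ℚₚ.+-monoʳ-≤ (f y) (∑ₗ-nonNeg xs 0≤f))
  ∈⇒≤∑ₗ {f} (y ∷ xs) 0≤f (there x∈xs) =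
    ℚₚ.≤-trans (∈⇒≤∑ₗ xs 0≤f x∈xs)
      (subst (_≤ f y + ∑ₗ f xs) (ℚₚ.+-identityˡ (∑ₗ f xs)) (ℚₚ.+-monoˡ-≤ (∑ₗ f xs) (0≤f y)))

  ∑ₗ-filter-≤ : ∀ {p} {P : A → Set p} (P? : ∀ x → Dec (P x)) {f : A → ℚ} (xs : List A) →
    (∀ x → 0ℚ ≤ f x) → ∑ₗ f (filter P? xs) ≤ ∑ₗ f xs
  ∑ₗ-filter-≤ P? {f} xs 0≤f = subst (_≤ ∑ₗ f xs) (sym (∑ₗ-filter P? f xs))
    (∑ₗ-mono-≤ xs (λ x → 𝟙·≤ (P? x) (0≤f x)))

  ∑ₗ-deduplicate-≤ : (_≟_ : DecidableEquality A) {f : A → ℚ} (xs : List A) →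
    (∀ x → 0ℚ ≤ f x) → ∑ₗ f (deduplicate _≟_ xs) ≤ ∑ₗ f xs
  ∑ₗ-deduplicate-≤ _≟_ []       0≤f = ℚₚ.≤-refl
  ∑ₗ-deduplicate-≤ _≟_ {f} (x ∷ xs) 0≤f = ℚₚ.+-monoʳ-≤ (f x) (ℚₚ.≤-trans
    (∑ₗ-filter-≤ (¬? ∘ (x ≟_)) (deduplicate _≟_ xs) 0≤f) (∑ₗ-deduplicate-≤ _≟_ xs 0≤f))

  ∑ₗ-tabulate : ∀ {k} (f : A → ℚ) (g : Fin k → A) → ∑ₗ f (tabulate g) ≡ ∑[ j < k ] f (g j)
  ∑ₗ-tabulate {zero}  f g = refl
  ∑ₗ-tabulate {suc k} f g = cong (f (g fzero) +_) (∑ₗ-tabulate f (g ∘ fsuc))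

  ∑ᵛ-∑ₗ-comm : ∀ {k n} (f : Vec (Fin k) n → A → ℚ) xs →
    ∑ᵛ (λ σ → ∑ₗ (f σ) xs) ≡ ∑ₗ (λ x → ∑ᵛ (λ σ → f σ x)) xs
  ∑ᵛ-∑ₗ-comm {n = n} f []       = ∑ᵛ-zero {n = n}
  ∑ᵛ-∑ₗ-comm f (x ∷ xs) = trans (∑ᵛ-distrib-+ (λ σ → f σ x) (λ σ → ∑ₗ (f σ) xs))
    (cong (∑ᵛ (λ σ → f σ x) +_) (∑ᵛ-∑ₗ-comm f xs))

module _ {a b} {A : Set a} {B : Set b} where

  ∑ₗ-map : ∀ (f : B → ℚ) (g : A → B) xs → ∑ₗ f (map g xs) ≡ ∑ₗ (f ∘ g) xs
  ∑ₗ-map f g xs = cong (foldr _+_ 0ℚ) (sym (Listₚ.map-∘ xs))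

  ∑ₗ-concatMap : ∀ (f : B → ℚ) (g : A → List B) xs →
    ∑ₗ f (concatMap g xs) ≡ ∑ₗ (∑ₗ f ∘ g) xs
  ∑ₗ-concatMap f g []       = refl
  ∑ₗ-concatMap f g (x ∷ xs) =
    trans (∑ₗ-++ f (g x) _) (cong (∑ₗ f (g x) +_) (∑ₗ-concatMap f g xs))

∣++∣ : ∀ {a b} (S : Subset a) (T : Subset b) → ∣ S ++ T ∣ ≡ ∣ S ∣ ℕ.+ ∣ T ∣
∣++∣ []             T = refl
∣++∣ (inside  ∷ S) T = cong suc (∣++∣ S T)
∣++∣ (outside ∷ S) T = ∣++∣ S T

++-⊆⁺ : ∀ {a b} {S T : Subset a} {S′ T′ : Subset b} →
  S ⊆ T → S′ ⊆ T′ → S ++ S′ ⊆ T ++ T′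
++-⊆⁺ {S = []}          {[]}    _   S′⊆T′ = S′⊆T′
++-⊆⁺ {S = outside ∷ S} {t ∷ T} S⊆T S′⊆T′ = out⊆ (++-⊆⁺ (drop-∷-⊆ S⊆T) S′⊆T′)
++-⊆⁺ {S = inside  ∷ S} {t ∷ T} S⊆T S′⊆T′ with S⊆T here
... | here = in⊆in (++-⊆⁺ (drop-∷-⊆ S⊆T) S′⊆T′)

++-⊆⁻ : ∀ {a b} {S T : Subset a} {S′ T′ : Subset b} →
  S ++ S′ ⊆ T ++ T′ → S ⊆ T × S′ ⊆ T′
++-⊆⁻ {S = []}          {[]}    h = (λ ()) , h
++-⊆⁻ {S = outside ∷ S} {t ∷ T} h with ++-⊆⁻ {S = S} {T} (drop-∷-⊆ h)
... | S⊆T , S′⊆T′ = out⊆ S⊆T , S′⊆T′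
++-⊆⁻ {S = inside  ∷ S} {t ∷ T} h with h here | ++-⊆⁻ {S = S} {T} (drop-∷-⊆ h)
... | here | S⊆T , S′⊆T′ = in⊆in S⊆T , S′⊆T′

++-⊆⇔ : ∀ {a b} {S T : Subset a} {S′ T′ : Subset b} →
  S ++ S′ ⊆ T ++ T′ ⇔ (S ⊆ T × S′ ⊆ T′)
++-⊆⇔ = mk⇔ ++-⊆⁻ (λ (S⊆T , S′⊆T′) → ++-⊆⁺ S⊆T S′⊆T′)

⊆⁅⁆⇒≡⊥⊎≡⁅⁆ : ∀ {k} {S : Subset k} (i : Fin k) → S ⊆ ⁅ i ⁆ → S ≡ ⊥ ⊎ S ≡ ⁅ i ⁆
⊆⁅⁆⇒≡⊥⊎≡⁅⁆ {S = s ∷ S} fzero S⊆⁅i⁆ with ⊆-antisym (drop-∷-⊆ S⊆⁅i⁆) ⊥⊆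
⊆⁅⁆⇒≡⊥⊎≡⁅⁆ {S = outside ∷ S} fzero _ | refl = inj₁ refl
⊆⁅⁆⇒≡⊥⊎≡⁅⁆ {S = inside  ∷ S} fzero _ | refl = inj₂ refl
⊆⁅⁆⇒≡⊥⊎≡⁅⁆ {S = outside ∷ S} (fsuc i) S⊆⁅i⁆ =
  Sum.map (cong (outside ∷_)) (cong (outside ∷_)) (⊆⁅⁆⇒≡⊥⊎≡⁅⁆ i (drop-∷-⊆ S⊆⁅i⁆))
⊆⁅⁆⇒≡⊥⊎≡⁅⁆ {S = inside  ∷ S} (fsuc i) S⊆⁅i⁆ with S⊆⁅i⁆ here
... | ()

⁅⁆⊆⁅⁆⇔≡ : ∀ {k} {i j : Fin k} → ⁅ i ⁆ ⊆ ⁅ j ⁆ ⇔ i ≡ j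
⁅⁆⊆⁅⁆⇔≡ {i = i} {j} =
  mk⇔ (λ i⊆j → x∈⁅y⁆⇒x≡y j (i⊆j (x∈⁅x⁆ i))) (λ { refl → ⊆-refl })

_≟ₛ_ : ∀ {m} → DecidableEquality (Subset m)
_≟ₛ_ = Vecₚ.≡-dec Boolₚ._≟_

anyᵇ≡true⇔∃ : ∀ k {f : Fin k → Bool} → anyᵇ k f ≡ true ⇔ ∃ λ j → f j ≡ true
anyᵇ≡true⇔∃ k = mk⇔ (⇒ k) (λ (j , fj) → ⇐ k j fj)
  where
  ⇒ : ∀ k {f : Fin k → Bool} → anyᵇ k f ≡ true → ∃ λ j → f j ≡ true
  ⇒ (suc k) {f} anyf with f fzero in f₀
  ... | true  = fzero , f₀
  ... | false = Product.map fsuc id (⇒ k anyf)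
  ⇐ : ∀ k {f : Fin k → Bool} j → f j ≡ true → anyᵇ k f ≡ true
  ⇐ (suc k) fzero    f₀ rewrite f₀ = refl
  ⇐ (suc k) {f} (fsuc j) fj = trans (cong (f fzero ∨_) (⇐ k j fj)) (Boolₚ.∨-zeroʳ (f fzero))

anyᵇ-⊥ : ∀ k → anyᵇ k (lookup (⊥ {k})) ≡ false
anyᵇ-⊥ zero    = refl
anyᵇ-⊥ (suc k) = anyᵇ-⊥ k

anyᵇ-⁅⁆ : ∀ {k} (i : Fin k) → anyᵇ k (lookup ⁅ i ⁆) ≡ true
anyᵇ-⁅⁆ {k} i = Equivalence.from (anyᵇ≡true⇔∃ k) (i , Vecₚ.[]=⇒lookup (x∈⁅x⁆ i))

image-++ : ∀ {n} k (S : Subset k) (T : Subset (n * k)) →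
  image {suc n} k (S ++ T) ≡ anyᵇ k (lookup S) ∷ image k T
image-++ k S T = cong₂ _∷_
  (anyᵇ-cong k (Vecₚ.lookup-++ˡ S T))
  (Vecₚ.tabulate-cong (λ x → anyᵇ-cong k (λ j → Vecₚ.lookup-++ʳ S T (combine x j))))
  where
  anyᵇ-cong : ∀ k {f g : Fin k → Bool} → (∀ j → f j ≡ g j) → anyᵇ k f ≡ anyᵇ k g
  anyᵇ-cong zero    f≡g = refl
  anyᵇ-cong (suc k) f≡g = cong₂ _∨_ (f≡g fzero) (anyᵇ-cong k (f≡g ∘ fsuc))

∈-image⇔ : ∀ {n} k {S : Subset (n * k)} {x} → x ∈ image {n} k S ⇔ ∃ λ j → combine x j ∈ S
∈-image⇔ {n} k {S} {x} = mk⇔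
  (λ x∈πS → Product.map₂ (Vecₚ.lookup⇒[]= _ S) (Equivalence.to (anyᵇ≡true⇔∃ k)
    (trans (sym (Vecₚ.lookup∘tabulate _ x)) (Vecₚ.[]=⇒lookup x∈πS))))
  (λ (j , xj∈S) → Vecₚ.lookup⇒[]= x (image {n} k S) (trans (Vecₚ.lookup∘tabulate _ x)
    (Equivalence.from (anyᵇ≡true⇔∃ k) (j , Vecₚ.[]=⇒lookup xj∈S))))

image-mono : ∀ {n} k {S T : Subset (n * k)} → S ⊆ T → image {n} k S ⊆ image {n} k T
image-mono k S⊆T =
  Equivalence.from (∈-image⇔ k) ∘ Product.map₂ S⊆T ∘ Equivalence.to (∈-image⇔ k)

-- Defs lays out X × [k] as n consecutive blocks of length k (combine x j is the j-th point of block x),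
-- so the graph {(x , σ x)} of σ is the concatenation of the singletons ⁅ σ x ⁆.
graph : ∀ {k n} → Vec (Fin k) n → Subset (n * k)
graph []      = []
graph (j ∷ σ) = ⁅ j ⁆ ++ graph σ

image-graph : ∀ {k n} (σ : Vec (Fin k) n) → image {n} k (graph σ) ≡ ⊤
image-graph          []      = refl
image-graph {k} {suc n} (j ∷ σ) =
  trans (image-++ {n} k ⁅ j ⁆ (graph σ)) (cong₂ _∷_ (anyᵇ-⁅⁆ j) (image-graph σ))

∣anyᵇ∣≡∣∣ : ∀ {k} {B : Subset k} (j : Fin k) → B ⊆ ⁅ j ⁆ →
  ∣ anyᵇ k (lookup B) ∷ [] ∣ ≡ ∣ B ∣
∣anyᵇ∣≡∣∣ {k} j B⊆j with ⊆⁅⁆⇒≡⊥⊎≡⁅⁆ j B⊆j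
... | inj₁ refl = trans (cong (λ b → ∣ b ∷ [] ∣) (anyᵇ-⊥ k))   (sym (∣⊥∣≡0 k))
... | inj₂ refl = trans (cong (λ b → ∣ b ∷ [] ∣) (anyᵇ-⁅⁆ j)) (sym (∣⁅x⁆∣≡1 j))

∣image∣≡∣∣ : ∀ {k n} (σ : Vec (Fin k) n) {S : Subset (n * k)} → S ⊆ graph σ →
  ∣ image {n} k S ∣ ≡ ∣ S ∣
∣image∣≡∣∣ [] {[]} _ = refl
∣image∣≡∣∣ {k} {suc n} (j ∷ σ) {S} S⊆jσ with splitAt k S
... | B , S′ , refl with ++-⊆⁻ {S = B} S⊆jσ
... | B⊆j , S′⊆σ = begin
  ∣ image {suc n} k (B ++ S′) ∣
    ≡⟨ cong ∣_∣ (image-++ {n} k B S′) ⟩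
  ∣ (anyᵇ k (lookup B) ∷ []) ++ image {n} k S′ ∣
    ≡⟨ ∣++∣ (anyᵇ k (lookup B) ∷ []) (image {n} k S′) ⟩
  ∣ anyᵇ k (lookup B) ∷ [] ∣ ℕ.+ ∣ image {n} k S′ ∣
    ≡⟨ cong₂ ℕ._+_ (∣anyᵇ∣≡∣∣ j B⊆j) (∣image∣≡∣∣ σ S′⊆σ) ⟩
  ∣ B ∣ ℕ.+ ∣ S′ ∣
    ≡⟨ sym (∣++∣ B S′) ⟩
  ∣ B ++ S′ ∣
    ∎
  where open ≡-Reasoning

-- Lifting a cover of F to a cover of F_k

cost-cartesianProduct : ∀ {a b} q (𝒜 : List (Subset a)) (ℬ : List (Subset b)) →
  cost q (cartesianProductWith _++_ 𝒜 ℬ) ≡ cost q 𝒜 · cost q ℬ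
cost-cartesianProduct q []      ℬ = sym (ℚₚ.*-zeroˡ (cost q ℬ))
cost-cartesianProduct q (A ∷ 𝒜) ℬ = begin
  cost q (map (A ++_) ℬ ++ₗ cartesianProductWith _++_ 𝒜 ℬ)
    ≡⟨ ∑ₗ-++ (λ S → q ^ℚ ∣ S ∣) (map (A ++_) ℬ) _ ⟩
  cost q (map (A ++_) ℬ) + cost q (cartesianProductWith _++_ 𝒜 ℬ)
    ≡⟨ cong₂ _+_ cost-translate (cost-cartesianProduct q 𝒜 ℬ) ⟩
  q ^ℚ ∣ A ∣ · cost q ℬ + cost q 𝒜 · cost q ℬ
    ≡⟨ sym (ℚₚ.*-distribʳ-+ (cost q ℬ) (q ^ℚ ∣ A ∣) (cost q 𝒜)) ⟩
  (q ^ℚ ∣ A ∣ + cost q 𝒜) · cost q ℬ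
    ∎
  where
  open ≡-Reasoning
  cost-translate : cost q (map (A ++_) ℬ) ≡ q ^ℚ ∣ A ∣ · cost q ℬ
  cost-translate = begin
    cost q (map (A ++_) ℬ)
      ≡⟨ ∑ₗ-map (λ S → q ^ℚ ∣ S ∣) (A ++_) ℬ ⟩
    ∑ₗ (λ B → q ^ℚ ∣ A ++ B ∣) ℬ
      ≡⟨ ∑ₗ-cong ℬ (λ B → trans (cong (q ^ℚ_) (∣++∣ A B)) (^-+ q ∣ A ∣ ∣ B ∣)) ⟩
    ∑ₗ (λ B → q ^ℚ ∣ A ∣ · q ^ℚ ∣ B ∣) ℬ
      ≡⟨ sym (·-distribˡ-∑ₗ (q ^ℚ ∣ A ∣) (λ B → q ^ℚ ∣ B ∣) ℬ) ⟩
    q ^ℚ ∣ A ∣ · cost q ℬ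
      ∎

singletons : ∀ k → List (Subset k)
singletons k = tabulate ⁅_⁆

cost-singletons : ∀ k q → cost q (singletons k) ≡ q · fromℕ k
cost-singletons k q = begin
  cost q (singletons k)             ≡⟨ ∑ₗ-tabulate (λ S → q ^ℚ ∣ S ∣) (⁅_⁆ {k}) ⟩
  ∑[ j < k ] q ^ℚ ∣ ⁅ j ⁆ ∣         ≡⟨ sum-cong-≗ {k} (λ j → cong (q ^ℚ_) (∣⁅x⁆∣≡1 j)) ⟩
  ∑[ j < k ] (q · 1ℚ)               ≡⟨ ∑-const k (q · 1ℚ) ⟩
  fromℕ k · (q · 1ℚ)                ≡⟨ cong (fromℕ k ·_) (ℚₚ.*-identityʳ q) ⟩
  fromℕ k · q                       ≡⟨ ℚₚ.*-comm (fromℕ k) q ⟩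
  q · fromℕ k                       ∎
  where open ≡-Reasoning

blocks : ∀ k → Side → List (Subset k)
blocks k outside = ⊥ ∷ []
blocks k inside  = singletons k

-- The members of lifts k S meet the block of each x ∈ S in a single point and miss all other blocks.
lifts : ∀ {n} k → Subset n → List (Subset (n * k))
lifts k []      = [] ∷ []
lifts k (s ∷ S) = cartesianProductWith _++_ (blocks k s) (lifts k S)

cost-lifts : ∀ {n} k q (S : Subset n) → cost q (lifts k S) ≡ (q · fromℕ k) ^ℚ ∣ S ∣
cost-lifts k q []            = ℚₚ.+-identityʳ 1ℚ
cost-lifts k q (outside ∷ S) = begin
  cost q (lifts k (outside ∷ S))
    ≡⟨ cost-cartesianProduct q (blocks k outside) (lifts k S) ⟩
  (q ^ℚ ∣ ⊥ {k} ∣ + 0ℚ) · cost q (lifts k S)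
    ≡⟨ cong₂ _·_ (trans (cong (λ m → q ^ℚ m + 0ℚ) (∣⊥∣≡0 k)) (ℚₚ.+-identityʳ 1ℚ)) (cost-lifts k q S) ⟩
  1ℚ · (q · fromℕ k) ^ℚ ∣ S ∣
    ≡⟨ ℚₚ.*-identityˡ _ ⟩
  (q · fromℕ k) ^ℚ ∣ S ∣
    ∎
  where open ≡-Reasoning
cost-lifts k q (inside ∷ S)  = begin
  cost q (lifts k (inside ∷ S))
    ≡⟨ cost-cartesianProduct q (singletons k) (lifts k S) ⟩
  cost q (singletons k) · cost q (lifts k S)
    ≡⟨ cong₂ _·_ (cost-singletons k q) (cost-lifts k q S) ⟩
  (q · fromℕ k) · (q · fromℕ k) ^ℚ ∣ S ∣
    ∎
  where open ≡-Reasoning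

anyᵇ-blocks : ∀ {k} s {B : Subset k} → B ∈ₗ blocks k s → anyᵇ k (lookup B) ≡ s
anyᵇ-blocks {k} outside (here refl) = anyᵇ-⊥ k
anyᵇ-blocks {k} inside  B∈         with ∈-tabulate⁻ B∈
... | j , refl = anyᵇ-⁅⁆ j

∈-lifts⇒image≡ : ∀ {n} k (S : Subset n) {S′} → S′ ∈ₗ lifts k S → image {n} k S′ ≡ S
∈-lifts⇒image≡ k []      (here refl) = refl
∈-lifts⇒image≡ {suc n} k (s ∷ S) S′∈
  with ∈-cartesianProductWith⁻ _++_ (blocks k s) (lifts k S) S′∈
... | B , T , B∈ , T∈ , refl =
  trans (image-++ {n} k B T) (cong₂ _∷_ (anyᵇ-blocks s B∈) (∈-lifts⇒image≡ k S T∈))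

∃-block⊆ : ∀ {k} s (U : Subset k) → s ∷ [] ⊆ anyᵇ k (lookup U) ∷ [] →
  ∃ λ B → B ∈ₗ blocks k s × B ⊆ U
∃-block⊆     outside U _    = ⊥ , here refl , ⊥⊆
∃-block⊆ {k} inside  U s⊆U
  with Equivalence.to (anyᵇ≡true⇔∃ k) (Vecₚ.[]=⇒lookup (s⊆U here))
... | j , Uj = ⁅ j ⁆ , ∈-tabulate⁺ j ,
  λ x∈⁅j⁆ → subst (_∈ U) (sym (x∈⁅y⁆⇒x≡y j x∈⁅j⁆)) (Vecₚ.lookup⇒[]= j U Uj)

⊆-image⇒∃-lift : ∀ {n} k (S : Subset n) (T : Subset (n * k)) → S ⊆ image {n} k T →
  ∃ λ S′ → S′ ∈ₗ lifts k S × S′ ⊆ T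
⊆-image⇒∃-lift k []      [] _ = [] , here refl , ⊆-refl
⊆-image⇒∃-lift {suc n} k (s ∷ S) T S⊆πT with splitAt k T
... | U , T′ , refl with ++-⊆⁻ {S = s ∷ []} (subst (s ∷ S ⊆_) (image-++ {n} k U T′) S⊆πT)
... | s⊆U , S⊆πT′ with ∃-block⊆ s U s⊆U | ⊆-image⇒∃-lift k S T′ S⊆πT′
... | B , B∈ , B⊆U | S′ , S′∈ , S′⊆T′ =
  B ++ S′ , ∈-cartesianProductWith⁺ _++_ B∈ S′∈ , ++-⊆⁺ B⊆U S′⊆T′

liftCover : ∀ {n} k → List (Subset n) → List (Subset (n * k))
liftCover k 𝒢 = deduplicate _≟ₛ_ (concatMap (lifts k) 𝒢)

liftCover-covers : ∀ {n} k (F : Family n) (𝒢 : List (Subset n)) →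
  Covers 𝒢 F → Covers (liftCover k 𝒢) (clone k F)
liftCover-covers {n} k F 𝒢 covers T FπT with find (covers (image {n} k T) FπT)
... | S , S∈𝒢 , S⊆πT with ⊆-image⇒∃-lift k S T S⊆πT
... | S′ , S′∈ , S′⊆T =
  lose (∈-deduplicate⁺ _≟ₛ_ (∈-concatMap⁺ (lifts k) (lose S∈𝒢 S′∈))) S′⊆T

cost-liftCover≤ : ∀ {n} k q (𝒢 : List (Subset n)) → 0ℚ ≤ q →
  cost q (liftCover k 𝒢) ≤ cost (q · fromℕ k) 𝒢
cost-liftCover≤ k q 𝒢 0≤q = begin
  cost q (liftCover k 𝒢)
    ≤⟨ ∑ₗ-deduplicate-≤ _≟ₛ_ (concatMap (lifts k) 𝒢) (λ S → ^-nonNeg ∣ S ∣ 0≤q) ⟩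
  cost q (concatMap (lifts k) 𝒢)
    ≡⟨ ∑ₗ-concatMap (λ S → q ^ℚ ∣ S ∣) (lifts k) 𝒢 ⟩
  ∑ₗ (cost q ∘ lifts k) 𝒢
    ≡⟨ ∑ₗ-cong 𝒢 (cost-lifts k q) ⟩
  cost (q · fromℕ k) 𝒢
    ∎
  where open ℚₚ.≤-Reasoning

<⁻¹·qc⇒<qc-clone : ∀ {n} k (F : Family n) r → r <[ suc k ⁻¹·qc F ] → r <qc clone (suc k) F
<⁻¹·qc⇒<qc-clone k F r (_ , (0≤p , p≤1 , 𝒢 , _ , cheap , covers) , q , refl , r<q) =
  q , (0≤q , q≤1 , liftCover (suc k) 𝒢 , deduplicate-! _≟ₛ_ _ ,
       ℚₚ.≤-trans (cost-liftCover≤ (suc k) q 𝒢 0≤q) cheap ,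
       liftCover-covers (suc k) F 𝒢 covers) ,
  r<q
  where
  0≤q = 0≤·fromℕ-suc⇒0≤ k 0≤p
  q≤1 = ℚₚ.≤-trans (≤·fromℕ-suc k 0≤q) p≤1

-- Projecting a cover of F_k along a map σ : X → [k]

subsetWeight : ∀ {a} → ℚ → Subset a → Subset a → ℚ
subsetWeight x T S = 𝟙 (S ⊆? T) · x ^ℚ ∣ S ∣

subsetWeight-nonNeg : ∀ {a} {x} (T S : Subset a) → 0ℚ ≤ x → 0ℚ ≤ subsetWeight x T S
subsetWeight-nonNeg T S 0≤x = ·-nonNeg (𝟙-nonNeg (S ⊆? T)) (^-nonNeg ∣ S ∣ 0≤x)

subsetWeight-++ : ∀ {a b} x (T S : Subset a) (T′ S′ : Subset b) →
  subsetWeight x (T ++ T′) (S ++ S′) ≡ subsetWeight x T S · subsetWeight x T′ S′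
subsetWeight-++ x T S T′ S′ = begin
  𝟙 (S ++ S′ ⊆? T ++ T′) · x ^ℚ ∣ S ++ S′ ∣
    ≡⟨ cong₂ _·_ (trans (𝟙-⇔ ++-⊆⇔ (S ++ S′ ⊆? T ++ T′) ((S ⊆? T) ×-dec (S′ ⊆? T′)))
                        (𝟙-× (S ⊆? T) (S′ ⊆? T′)))
                 (trans (cong (x ^ℚ_) (∣++∣ S S′)) (^-+ x ∣ S ∣ ∣ S′ ∣)) ⟩
  (𝟙 (S ⊆? T) · 𝟙 (S′ ⊆? T′)) · (x ^ℚ ∣ S ∣ · x ^ℚ ∣ S′ ∣)
    ≡⟨ ·-interchange (𝟙 (S ⊆? T)) (𝟙 (S′ ⊆? T′)) (x ^ℚ ∣ S ∣) (x ^ℚ ∣ S′ ∣) ⟩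
  (𝟙 (S ⊆? T) · x ^ℚ ∣ S ∣) · (𝟙 (S′ ⊆? T′) · x ^ℚ ∣ S′ ∣)
    ∎
  where open ≡-Reasoning

-- A block B lies in ⁅ j ⁆ for all k values of j if B = ⊥, for exactly one j if B is a singleton
-- and for none otherwise, so the left-hand side is k, k · q or 0: never more than k · q ^ ∣ B ∣.
∑-subsetWeight-⁅⁆≤ : ∀ {k} q (B : Subset k) → 0ℚ ≤ q →
  ∑[ j < k ] subsetWeight (q · fromℕ k) ⁅ j ⁆ B ≤ ∑[ j < k ] q ^ℚ ∣ B ∣
∑-subsetWeight-⁅⁆≤ {k} q B 0≤q with any? (λ j → B ⊆? ⁅ j ⁆)
... | no B⊈⁅⁆ = ∑-mono-≤ λ j → subst (_≤ q ^ℚ ∣ B ∣) (sym (weight-zero j)) (^-nonNeg ∣ B ∣ 0≤q)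
  where
  weight-zero : ∀ j → subsetWeight (q · fromℕ k) ⁅ j ⁆ B ≡ 0ℚ
  weight-zero j = trans (cong (_· (q · fromℕ k) ^ℚ ∣ B ∣) (𝟙-no (B ⊆? ⁅ j ⁆) (λ B⊆j → B⊈⁅⁆ (j , B⊆j))))
                        (ℚₚ.*-zeroˡ ((q · fromℕ k) ^ℚ ∣ B ∣))
... | yes (i , B⊆i) with ⊆⁅⁆⇒≡⊥⊎≡⁅⁆ i B⊆i
...   | inj₁ refl = ℚₚ.≤-reflexive (sum-cong-≗ {k} λ j → begin
  𝟙 (⊥ ⊆? ⁅ j ⁆) · x ^ℚ ∣ ⊥ {k} ∣  ≡⟨ cong₂ _·_ (𝟙-yes (⊥ ⊆? ⁅ j ⁆) ⊥⊆) (cong (x ^ℚ_) (∣⊥∣≡0 k)) ⟩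
  1ℚ · 1ℚ                          ≡⟨ cong (1ℚ ·_) (cong (q ^ℚ_) (sym (∣⊥∣≡0 k))) ⟩
  1ℚ · q ^ℚ ∣ ⊥ {k} ∣              ≡⟨ ℚₚ.*-identityˡ (q ^ℚ ∣ ⊥ {k} ∣) ⟩
  q ^ℚ ∣ ⊥ {k} ∣                   ∎)
  where open ≡-Reasoning
        x = q · fromℕ k
...   | inj₂ refl = ℚₚ.≤-reflexive (begin
  ∑[ j < k ] (𝟙 (⁅ i ⁆ ⊆? ⁅ j ⁆) · x ^ℚ ∣ ⁅ i ⁆ ∣)
    ≡⟨ sym (*-distribʳ-sum (x ^ℚ ∣ ⁅ i ⁆ ∣) (λ j → 𝟙 (⁅ i ⁆ ⊆? ⁅ j ⁆))) ⟩
  (∑[ j < k ] 𝟙 (⁅ i ⁆ ⊆? ⁅ j ⁆)) · x ^ℚ ∣ ⁅ i ⁆ ∣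
    ≡⟨ cong₂ _·_ ∑-𝟙-⁅i⁆⊆ (cong (x ^ℚ_) (∣⁅x⁆∣≡1 i)) ⟩
  1ℚ · (x · 1ℚ)
    ≡⟨ trans (ℚₚ.*-identityˡ (x · 1ℚ)) (trans (ℚₚ.*-identityʳ x) (ℚₚ.*-comm q (fromℕ k))) ⟩
  fromℕ k · q
    ≡⟨ cong (fromℕ k ·_) (sym (ℚₚ.*-identityʳ q)) ⟩
  fromℕ k · q ^ℚ 1
    ≡⟨ sym (∑-const k (q ^ℚ 1)) ⟩
  ∑[ j < k ] q ^ℚ 1
    ≡⟨ sum-cong-≗ {k} (λ _ → cong (q ^ℚ_) (sym (∣⁅x⁆∣≡1 i))) ⟩
  ∑[ j < k ] q ^ℚ ∣ ⁅ i ⁆ ∣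
    ∎)
  where
  open ≡-Reasoning
  x = q · fromℕ k
  ∑-𝟙-⁅i⁆⊆ : ∑[ j < k ] 𝟙 (⁅ i ⁆ ⊆? ⁅ j ⁆) ≡ 1ℚ
  ∑-𝟙-⁅i⁆⊆ = trans (sum-cong-≗ {k} (λ j → 𝟙-⇔ ⁅⁆⊆⁅⁆⇔≡ (⁅ i ⁆ ⊆? ⁅ j ⁆) (i Fin.≟ j))) (∑-𝟙-≟ i)

∑ᵛ-subsetWeight-graph≤ : ∀ {k n} q (S : Subset (n * k)) → 0ℚ ≤ q →
  ∑ᵛ (λ (σ : Vec (Fin k) n) → subsetWeight (q · fromℕ k) (graph σ) S) ≤
  ∑ᵛ (λ (σ : Vec (Fin k) n) → q ^ℚ ∣ S ∣)
∑ᵛ-subsetWeight-graph≤ {n = zero} q [] 0≤q =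
  ℚₚ.≤-reflexive (trans (cong (_· 1ℚ) (𝟙-yes ([] ⊆? []) ⊆-refl)) (ℚₚ.*-identityˡ 1ℚ))
∑ᵛ-subsetWeight-graph≤ {k} {suc n} q S 0≤q with splitAt k S
... | B , S′ , refl = begin
  ∑[ j < k ] ∑ᵛ {k} {n} (λ σ → w (⁅ j ⁆ ++ graph σ) (B ++ S′))
    ≡⟨ sum-cong-≗ {k} (λ j → ∑ᵛ-cong {n = n} (λ σ → subsetWeight-++ x ⁅ j ⁆ B (graph σ) S′)) ⟩
  ∑[ j < k ] ∑ᵛ {k} {n} (λ σ → w ⁅ j ⁆ B · w (graph σ) S′)
    ≡⟨ sum-cong-≗ {k} (λ j → sym (·-distribˡ-∑ᵛ {n = n} (w ⁅ j ⁆ B) (λ σ → w (graph σ) S′))) ⟩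
  ∑[ j < k ] (w ⁅ j ⁆ B · ∑ᵛ {k} {n} (λ σ → w (graph σ) S′))
    ≤⟨ ∑-mono-≤ (λ j → ·-monoˡ-≤ (subsetWeight-nonNeg ⁅ j ⁆ B 0≤x)
                                  (∑ᵛ-subsetWeight-graph≤ {k} {n} q S′ 0≤q)) ⟩
  ∑[ j < k ] (w ⁅ j ⁆ B · R)
    ≡⟨ sym (*-distribʳ-sum R (λ j → w ⁅ j ⁆ B)) ⟩
  (∑[ j < k ] w ⁅ j ⁆ B) · R
    ≤⟨ ·-monoʳ-≤ (∑ᵛ-nonNeg {n = n} (λ _ → ^-nonNeg ∣ S′ ∣ 0≤q)) (∑-subsetWeight-⁅⁆≤ q B 0≤q) ⟩
  (∑[ j < k ] q ^ℚ ∣ B ∣) · R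
    ≡⟨ *-distribʳ-sum {k} R (λ _ → q ^ℚ ∣ B ∣) ⟩
  ∑[ j < k ] (q ^ℚ ∣ B ∣ · R)
    ≡⟨ sum-cong-≗ {k} (λ _ → ·-distribˡ-∑ᵛ {n = n} (q ^ℚ ∣ B ∣) (λ _ → q ^ℚ ∣ S′ ∣)) ⟩
  ∑[ j < k ] ∑ᵛ {k} {n} (λ _ → q ^ℚ ∣ B ∣ · q ^ℚ ∣ S′ ∣)
    ≡⟨ sum-cong-≗ {k} (λ _ → ∑ᵛ-cong {n = n} (λ _ → sym q^∣B++S′∣)) ⟩
  ∑[ j < k ] ∑ᵛ {k} {n} (λ _ → q ^ℚ ∣ B ++ S′ ∣)
    ∎
  where
  open ℚₚ.≤-Reasoning
  x = q · fromℕ k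
  0≤x = ·-nonNeg 0≤q (fromℕ-nonNeg k)
  w : ∀ {a} → Subset a → Subset a → ℚ
  w = subsetWeight x
  R = ∑ᵛ {k} {n} (λ _ → q ^ℚ ∣ S′ ∣)
  q^∣B++S′∣ : q ^ℚ ∣ B ++ S′ ∣ ≡ q ^ℚ ∣ B ∣ · q ^ℚ ∣ S′ ∣
  q^∣B++S′∣ = trans (cong (q ^ℚ_) (∣++∣ B S′)) (^-+ q ∣ B ∣ ∣ S′ ∣)

∃-light-graph : ∀ {k n} q (𝒢 : List (Subset (n * suc k))) → 0ℚ ≤ q →
  ∃ λ (σ : Vec (Fin (suc k)) n) → ∑ₗ (subsetWeight (q · fromℕ (suc k)) (graph σ)) 𝒢 ≤ cost q 𝒢
∃-light-graph {k} {n} q 𝒢 0≤q = ∑ᵛ-≤⇒∃-≤ _ _ (begin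
  ∑ᵛ (λ σ → ∑ₗ (w σ) 𝒢)                  ≡⟨ ∑ᵛ-∑ₗ-comm w 𝒢 ⟩
  ∑ₗ (λ S → ∑ᵛ (λ σ → w σ S)) 𝒢          ≤⟨ ∑ₗ-mono-≤ 𝒢 (λ S → ∑ᵛ-subsetWeight-graph≤ {n = n} q S 0≤q) ⟩
  ∑ₗ (λ S → ∑ᵛ (λ (_ : Vec (Fin (suc k)) n) → q ^ℚ ∣ S ∣)) 𝒢
                                         ≡⟨ sym (∑ᵛ-∑ₗ-comm {n = n} (λ _ S → q ^ℚ ∣ S ∣) 𝒢) ⟩
  ∑ᵛ (λ (_ : Vec (Fin (suc k)) n) → cost q 𝒢) ∎)
  where open ℚₚ.≤-Reasoning
        w : Vec (Fin (suc k)) n → Subset (n * suc k) → ℚ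
        w σ = subsetWeight (q · fromℕ (suc k)) (graph σ)

cheap-cover⇒≤1 : ∀ {m} {F : Family m} {x} {𝒢 : List (Subset m)} →
  ∃ F → Covers 𝒢 F → cost x 𝒢 ≤ ½ → x ≤ 1ℚ
cheap-cover⇒≤1 {x = x} {𝒢} (A , FA) covers cheap = ℚₚ.≮⇒≥ λ 1<x →
  let S , S∈𝒢 , _ = find (covers A FA)
      0≤x        = ℚₚ.<⇒≤ (ℚₚ.<-trans (ℚₚ.positive⁻¹ 1ℚ) 1<x)
  in ℚₚ.<-irrefl refl (ℚₚ.<-≤-trans ½<1 (begin
       1ℚ          ≤⟨ 1≤^ ∣ S ∣ (ℚₚ.<⇒≤ 1<x) ⟩
       x ^ℚ ∣ S ∣  ≤⟨ ∈⇒≤∑ₗ 𝒢 (λ T → ^-nonNeg ∣ T ∣ 0≤x) S∈𝒢 ⟩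
       cost x 𝒢    ≤⟨ cheap ⟩
       ½           ∎))
  where open ℚₚ.≤-Reasoning
        ½<1 : ½ < 1ℚ
        ½<1 = toWitness {a? = ½ <? 1ℚ} _

project : ∀ {n} k → Vec (Fin k) n → List (Subset (n * k)) → List (Subset n)
project k σ 𝒢 = deduplicate _≟ₛ_ (map (image k) (filter (_⊆? graph σ) 𝒢))

project-covers : ∀ {n} k (F : Family n) (σ : Vec (Fin k) n) (𝒢 : List (Subset (n * k))) →
  Covers 𝒢 (clone k F) → Covers (project k σ 𝒢) F
project-covers {n} k F σ 𝒢 covers T FT
  with ⊆-image⇒∃-lift k T (graph σ) (subst (T ⊆_) (sym (image-graph σ)) ⊆⊤)
... | T′ , T′∈ , T′⊆σ with find (covers T′ (subst F (sym (∈-lifts⇒image≡ k T T′∈)) FT))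
... | S , S∈𝒢 , S⊆T′ =
  lose (∈-deduplicate⁺ _≟ₛ_ (∈-map⁺ (image k) (∈-filter⁺ (_⊆? graph σ) S∈𝒢 (⊆-trans S⊆T′ T′⊆σ))))
       (subst (image {n} k S ⊆_) (∈-lifts⇒image≡ k T T′∈) (image-mono k S⊆T′))

cost-project≤ : ∀ {n} k x (σ : Vec (Fin k) n) (𝒢 : List (Subset (n * k))) → 0ℚ ≤ x →
  cost x (project k σ 𝒢) ≤ ∑ₗ (subsetWeight x (graph σ)) 𝒢
cost-project≤ {n} k x σ 𝒢 0≤x = begin
  cost x (project k σ 𝒢)
    ≤⟨ ∑ₗ-deduplicate-≤ _≟ₛ_ (map (image {n} k) (filter (_⊆? graph σ) 𝒢)) (λ S → ^-nonNeg ∣ S ∣ 0≤x) ⟩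
  cost x (map (image {n} k) (filter (_⊆? graph σ) 𝒢))
    ≡⟨ ∑ₗ-map (λ S → x ^ℚ ∣ S ∣) (image {n} k) (filter (_⊆? graph σ) 𝒢) ⟩
  ∑ₗ (λ S → x ^ℚ ∣ image {n} k S ∣) (filter (_⊆? graph σ) 𝒢)
    ≡⟨ ∑ₗ-filter (_⊆? graph σ) (λ S → x ^ℚ ∣ image {n} k S ∣) 𝒢 ⟩
  ∑ₗ (λ S → 𝟙 (S ⊆? graph σ) · x ^ℚ ∣ image {n} k S ∣) 𝒢
    ≡⟨ ∑ₗ-cong 𝒢 (λ S → 𝟙·-cong (S ⊆? graph σ) (cong (x ^ℚ_) ∘ ∣image∣≡∣∣ σ)) ⟩
  ∑ₗ (subsetWeight x (graph σ)) 𝒢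
    ∎
  where open ℚₚ.≤-Reasoning

<qc-clone⇒<⁻¹·qc : ∀ {n} k (F : Family n) → ∃ F → ∀ r →
  r <qc clone (suc k) F → r <[ suc k ⁻¹·qc F ]
<qc-clone⇒<⁻¹·qc {n} k F inhabited r (q , (0≤q , q≤1 , 𝒢 , _ , cheap , covers) , r<q)
  with ∃-light-graph q 𝒢 0≤q
... | σ , light =
  x , (0≤x , x≤1 , 𝒢σ , deduplicate-! _≟ₛ_ _ , cheapσ , coversσ) , q , refl , r<q
  where
  x = q · fromℕ (suc k)
  0≤x = ·-nonNeg 0≤q (fromℕ-nonNeg (suc k))
  𝒢σ = project (suc k) σ 𝒢
  cheapσ : cost x 𝒢σ ≤ ½
  cheapσ = ℚₚ.≤-trans (cost-project≤ (suc k) x σ 𝒢 0≤x) (ℚₚ.≤-trans light cheap)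
  coversσ : Covers 𝒢σ F
  coversσ = project-covers (suc k) F σ 𝒢 covers
  x≤1 = cheap-cover⇒≤1 inhabited coversσ cheapσ

lemma2p1 : (k n : ℕ) → k ≥ 1 → (F : Family n) → Increasing F → NonTrivial F →
    (r : ℚ) → (r <qc clone k F) ⇔ (r <[ k ⁻¹·qc F ])
lemma2p1 (suc k) n _ F _ (inhabited , _) r =
  mk⇔ (<qc-clone⇒<⁻¹·qc k F inhabited r) (<⁻¹·qc⇒<qc-clone k F r)
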